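{- Let $\mathcal{P}$ be a finite patchwork on a set $\Omega$. A subset $A$ of $\Omega$ is a $\mathcal{P}$-set if and only if it can be written as the union of a family of autonomous sets whose adjacency graph is connected.
   Context: Subsets $A,B\subseteq\Omega$ overlap if $A\cap B\neq\emptyset$ but neither contains the other. A patchwork on $\Omega$ is a set $\mathcal{P}$ of subsets of $\Omega$ such that $\emptyset,\Omega\in\mathcal{P}$ and for every pair of overlapping $A,B\in\mathcal{P}$, the sets $A\cap B$, $A\cup B$, $A\setminus B$ belong to $\mathcal{P}$. Members of $\mathcal{P}$ are called $\mathcal{P}$-sets. A $\mathcal{P}$-set is autonomous if it is nonempty and does not overlap any member of $\mathcal{P}$. Two $\mathcal{P}$-sets are adjacent if they are disjoint and their union is again a $\mathcal{P}$-set. The adjacency graph of a family of $\mathcal{P}$-sets is the graph whose vertices are the members of the family, with an edge between two vertices iff they are adjacent. -}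

module Defs where

open import Level using (0ℓ)
open import Data.Product using (Σ; ∃; _×_; _,_)
open import Data.Empty using (⊥)
open import Data.List using (List)
open import Data.List.Relation.Unary.Any using (Any)
open import Data.List.Relation.Unary.All using (All)
open import Data.List.Membership.Propositional using (_∈_)
open import Relation.Nullary using (¬_)

Subset : Set → Set₁
Subset Ω = Ω → Set

module _ {Ω : Set} where

  _⊆_ : Subset Ω → Subset Ω → Set
  A ⊆ B = ∀ x → A x → B x

  _≐_ : Subset Ω → Subset Ω → Set
  A ≐ B = A ⊆ B × B ⊆ A

  ∅ : Subset Ω
  ∅ _ = ⊥

  Full : Subset Ω
  Full _ = Data.Unit.⊤
    where import Data.Unit

  _∩_ : Subset Ω → Subset Ω → Subset Ω
  (A ∩ B) x = A x × B x

  _∪_ : Subset Ω → Subset Ω → Subset Ω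
  (A ∪ B) x = Data.Sum._⊎_ (A x) (B x)
    where import Data.Sum

  _∖_ : Subset Ω → Subset Ω → Subset Ω
  (A ∖ B) x = A x × ¬ B x

  Nonempty : Subset Ω → Set
  Nonempty A = ∃ λ x → A x

  Disjoint : Subset Ω → Subset Ω → Set
  Disjoint A B = ¬ Nonempty (A ∩ B)

  Overlap : Subset Ω → Subset Ω → Set
  Overlap A B = Nonempty (A ∩ B) × ¬ (A ⊆ B) × ¬ (B ⊆ A)

  -- A finite family of subsets is a list; A is a P-set iff it equals
  -- (extensionally) some member of the list P.
  _∈P_ : Subset Ω → List (Subset Ω) → Set₁
  A ∈P P = Any (λ B → A ≐ B) P

  IsPatchwork : List (Subset Ω) → Set₁
  IsPatchwork P =
    ∅ ∈P P × Full ∈P P ×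
    (∀ A B → A ∈P P → B ∈P P → Overlap A B →
       ((A ∩ B) ∈P P) × ((A ∪ B) ∈P P) × ((A ∖ B) ∈P P))

  Autonomous : List (Subset Ω) → Subset Ω → Set₁
  Autonomous P A = A ∈P P × Nonempty A × All (λ B → ¬ Overlap A B) P

  Adjacent : List (Subset Ω) → Subset Ω → Subset Ω → Set₁
  Adjacent P A B = A ∈P P × B ∈P P × Disjoint A B × (A ∪ B) ∈P P

  _IsUnionOf_ : Subset Ω → List (Subset Ω) → Set₁
  A IsUnionOf F = ∀ x → (A x → ∃ λ C → C ∈ F × C x)
                      × ((∃ λ C → C ∈ F × C x) → A x)

  -- walks in the adjacency graph of the family F (vertices: members of F,
  -- identified up to extensional equality)
  data Walk (P F : List (Subset Ω)) : Subset Ω → Subset Ω → Set₁ where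
    here : ∀ {A B} → A ≐ B → Walk P F A B
    step : ∀ {A B C} → C ∈ F → Adjacent P A C → Walk P F C B → Walk P F A B

  -- the adjacency graph of F is connected: any two vertices are joined by a walk
  -- (the empty graph counts as connected)
  Connected : List (Subset Ω) → List (Subset Ω) → Set₁
  Connected P F = ∀ {A B} → A ∈ F → B ∈ F → Walk P F A B

-- Backward: walking along the adjacency graph from one member, a P-set U already containing a
-- member C can swallow a neighbour D of C, since U and C ∪ D meet in C and so are nested or
-- overlapping.  Forward: the maximal autonomous subsets of A cover A (a minimal P-set around a
-- point is autonomous).  Their connectivity is proved inside every P-set W ⊆ A by induction on
-- W: if W is not inside a single member it is not autonomous, so it overlaps some B and splits
-- into the smaller P-sets X = W ∩ B and Y = W ∖ B.  If no member in X were linked to a member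
-- in Y, no P-set could overlap X, so X would be autonomous and equal to a member; likewise Y,
-- and these two members would be adjacent.
module Submission where

open import Defs
open import Level using (0ℓ; _⊔_; lift; lower) renaming (suc to lsuc)
open import Axiom.ExcludedMiddle using (ExcludedMiddle)
open import Data.Product using (∃; _×_; _,_; proj₁; proj₂)
open import Data.Sum using (_⊎_; inj₁; inj₂; swap)
open import Data.Empty using (⊥; ⊥-elim)
open import Data.List using (List; []; _∷_; filter)
open import Data.List.Relation.Unary.All as All using (All)
open import Data.List.Relation.Unary.All.Properties using (¬Any⇒All¬)
open import Data.List.Relation.Unary.Any as Any using (Any; here; there)
open import Data.List.Membership.Propositional using (_∈_; find; lose)
open import Data.List.Membership.Propositional.Properties using (∈-filter⁺; ∈-filter⁻)
open import Function.Bundles using (_⇔_; mk⇔)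
open import Relation.Nullary using (¬_; Dec; yes; no)
open import Relation.Nullary.Decidable using (map′; ¬?; _×-dec_)
open import Relation.Unary using (Decidable)
open import Relation.Binary.PropositionalEquality using (refl)

module _ {Ω : Set} where

  ⊆-refl : {A : Subset Ω} → A ⊆ A
  ⊆-refl _ a = a

  ⊆-trans : {A B C : Subset Ω} → A ⊆ B → B ⊆ C → A ⊆ C
  ⊆-trans A⊆B B⊆C x a = B⊆C x (A⊆B x a)

  ≐-refl : {A : Subset Ω} → A ≐ A
  ≐-refl = ⊆-refl , ⊆-refl

  ≐-sym : {A B : Subset Ω} → A ≐ B → B ≐ A
  ≐-sym (A⊆B , B⊆A) = B⊆A , A⊆B

  ≐-trans : {A B C : Subset Ω} → A ≐ B → B ≐ C → A ≐ C
  ≐-trans (A⊆B , B⊆A) (B⊆C , C⊆B) = ⊆-trans A⊆B B⊆C , ⊆-trans C⊆B B⊆A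

  ∩-⊆ˡ : {A B : Subset Ω} → (A ∩ B) ⊆ A
  ∩-⊆ˡ _ = proj₁

  ∖-⊆ : {A B : Subset Ω} → (A ∖ B) ⊆ A
  ∖-⊆ _ = proj₁

  ⊆-∪ˡ : {A B : Subset Ω} → A ⊆ (A ∪ B)
  ⊆-∪ˡ _ = inj₁

  ⊆-∪ʳ : {A B : Subset Ω} → B ⊆ (A ∪ B)
  ⊆-∪ʳ _ = inj₂

  ∪-⊆ : {A B C : Subset Ω} → A ⊆ C → B ⊆ C → (A ∪ B) ⊆ C
  ∪-⊆ A⊆C B⊆C x (inj₁ a) = A⊆C x a
  ∪-⊆ A⊆C B⊆C x (inj₂ b) = B⊆C x b

  ∪-comm : {A B : Subset Ω} → (A ∪ B) ≐ (B ∪ A)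
  ∪-comm = ∪-⊆ ⊆-∪ʳ ⊆-∪ˡ , ∪-⊆ ⊆-∪ʳ ⊆-∪ˡ

  ∪-congˡ : {A A' B : Subset Ω} → A ≐ A' → (A ∪ B) ≐ (A' ∪ B)
  ∪-congˡ (A⊆A' , A'⊆A) = ∪-⊆ (⊆-trans A⊆A' ⊆-∪ˡ) ⊆-∪ʳ , ∪-⊆ (⊆-trans A'⊆A ⊆-∪ˡ) ⊆-∪ʳ

  Disjoint-sym : {A B : Subset Ω} → Disjoint A B → Disjoint B A
  Disjoint-sym A∩B=∅ (x , Bx , Ax) = A∩B=∅ (x , Ax , Bx)

  ∈P-resp-≐ : {A A' : Subset Ω} {L : List (Subset Ω)} → A ≐ A' → A ∈P L → A' ∈P L
  ∈P-resp-≐ A≐A' = Any.map (≐-trans (≐-sym A≐A'))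

  ∈⇒∈P : {A : Subset Ω} {L : List (Subset Ω)} → A ∈ L → A ∈P L
  ∈⇒∈P = Any.map λ { refl → ≐-refl }

  union-⊇ : {A : Subset Ω} {F : List (Subset Ω)} → A IsUnionOf F → ∀ {C} → C ∈ F → C ⊆ A
  union-⊇ A=⋃F c x Cx = proj₂ (A=⋃F x) (_ , c , Cx)

  ⊆-union : {A U : Subset Ω} {F : List (Subset Ω)} → A IsUnionOf F → (∀ {C} → C ∈ F → C ⊆ U) → A ⊆ U
  ⊆-union A=⋃F F⊆U x Ax with proj₁ (A=⋃F x) Ax
  ... | _ , c , Cx = F⊆U c x Cx

  overlap-respˡ : {A A' B : Subset Ω} → A ≐ A' → Overlap A B → Overlap A' B
  overlap-respˡ (A⊆A' , A'⊆A) ((x , Ax , Bx) , A⊈B , B⊈A) =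
    (x , A⊆A' x Ax , Bx) , (λ A'⊆B → A⊈B (⊆-trans A⊆A' A'⊆B)) , (λ B⊆A' → B⊈A (⊆-trans B⊆A' A'⊆A))

  overlap-respʳ : {A B B' : Subset Ω} → B ≐ B' → Overlap A B → Overlap A B'
  overlap-respʳ (B⊆B' , B'⊆B) ((x , Ax , Bx) , A⊈B , B⊈A) =
    (x , Ax , B⊆B' x Bx) , (λ A⊆B' → A⊈B (⊆-trans A⊆B' B'⊆B)) , (λ B'⊆A → B⊈A (⊆-trans B⊆B' B'⊆A))

module _ {Ω : Set} {P : List (Subset Ω)} where

  autonomous-resp-≐ : {A A' : Subset Ω} → A ≐ A' → Autonomous P A → Autonomous P A'
  autonomous-resp-≐ A≐A' (a , (x , Ax) , ¬overlaps) =
    ∈P-resp-≐ A≐A' a , (x , proj₁ A≐A' x Ax) ,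
    All.map (λ ¬o o → ¬o (overlap-respˡ (≐-sym A≐A') o)) ¬overlaps

  autonomous⇒¬overlap : {C B : Subset Ω} → Autonomous P C → B ∈P P → ¬ Overlap C B
  autonomous⇒¬overlap (_ , _ , ¬overlaps) b o with find b
  ... | B' , b' , B≐B' = All.lookup ¬overlaps b' (overlap-respʳ B≐B' o)

  adjacent-sym : {A C : Subset Ω} → Adjacent P A C → Adjacent P C A
  adjacent-sym (a , c , disjoint , a∪c) = c , a , Disjoint-sym disjoint , ∈P-resp-≐ ∪-comm a∪c

  adjacent-respˡ : {A A' C : Subset Ω} → A ≐ A' → Adjacent P A C → Adjacent P A' C
  adjacent-respˡ A≐A' (a , c , disjoint , a∪c) =
    ∈P-resp-≐ A≐A' a , c , (λ (x , A'x , Cx) → disjoint (x , proj₂ A≐A' x A'x , Cx)) ,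
    ∈P-resp-≐ (∪-congˡ A≐A') a∪c

  module _ {F : List (Subset Ω)} where

    walk-respˡ : {A A' B : Subset Ω} → A ≐ A' → Walk P F A B → Walk P F A' B
    walk-respˡ A≐A' (here A≐B) = here (≐-trans (≐-sym A≐A') A≐B)
    walk-respˡ A≐A' (step c adj w) = step c (adjacent-respˡ A≐A' adj) w

    infixr 5 _◅◅_
    _◅◅_ : {A B C : Subset Ω} → Walk P F A B → Walk P F B C → Walk P F A C
    here A≐B ◅◅ w' = walk-respˡ (≐-sym A≐B) w'
    step c adj w ◅◅ w' = step c adj (w ◅◅ w')

    walk-reverse : {A B : Subset Ω} → A ∈ F → Walk P F A B → Walk P F B A
    walk-reverse a (here A≐B) = here (≐-sym A≐B)
    walk-reverse a (step c adj w) = walk-reverse c w ◅◅ step a (adjacent-sym adj) (here ≐-refl)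

module _ {a r} {X : Set a} (R : X → X → Set r) (R? : ∀ x y → Dec (R x y))
         (R-trans : ∀ {x y z} → R x y → R y z → R x z) where

  Maximal : ∀ {q} → (X → Set q) → List X → Set (a ⊔ r ⊔ q)
  Maximal Q L = ∃ λ M → M ∈ L × Q M × (∀ {E} → E ∈ L → Q E → R M E → R E M)

  maximal : ∀ {q} {Q : X → Set q} → Decidable Q → (L : List X) → Any Q L → Maximal Q L
  maximal {Q = Q} Q? (E ∷ L) q with Any.any? Q? L
  maximal {Q = Q} Q? (E ∷ L) (here QE) | no ¬QL = E , here refl , QE , E-max
    where
      E-max : ∀ {E'} → E' ∈ E ∷ L → Q E' → R E E' → R E' E
      E-max (here refl) _ E≤E = E≤E
      E-max (there e') QE' _ = ⊥-elim (¬QL (lose e' QE'))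
  maximal Q? (E ∷ L) (there QL) | no ¬QL = ⊥-elim (¬QL QL)
  maximal {Q = Q} Q? (E ∷ L) _ | yes QL with maximal Q? L QL
  ... | M , m , QM , M-max with Q? E ×-dec R? M E ×-dec ¬? (R? E M)
  ...   | yes (QE , M≤E , E≰M) = E , here refl , QE , E-max
    where
      E-max : ∀ {E'} → E' ∈ E ∷ L → Q E' → R E E' → R E' E
      E-max (here refl) _ E≤E = E≤E
      E-max (there e') QE' E≤E' = R-trans (M-max e' QE' (R-trans M≤E E≤E')) M≤E
  ...   | no ¬E-above = M , there m , QM , M-max'
    where
      M-max' : ∀ {E'} → E' ∈ E ∷ L → Q E' → R M E' → R E' M
      M-max' (here refl) QE M≤E with R? E M
      ... | yes E≤M = E≤M
      ... | no E≰M = ⊥-elim (¬E-above (QE , M≤E , E≰M))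
      M-max' (there e') = M-max e'

  finite-induction : ∀ {q} {Q : X → Set q} → Decidable Q → (L : List X) →
    (∀ {W} → W ∈ L → (∀ {V} → V ∈ L → R W V → ¬ R V W → Q V) → Q W) →
    ∀ {W} → W ∈ L → Q W
  finite-induction {Q = Q} Q? L ind {W} w with Q? W
  ... | yes QW = QW
  ... | no ¬QW with maximal (λ V → ¬? (Q? V)) L (lose w ¬QW)
  ...   | M , m , ¬QM , M-max = ⊥-elim (¬QM (ind m below-M))
    where
      below-M : ∀ {V} → V ∈ L → R M V → ¬ R V M → Q V
      below-M {V} v M≤V V≰M with Q? V
      ... | yes QV = QV
      ... | no ¬QV = ⊥-elim (V≰M (M-max v ¬QV M≤V))

module _ (em : ExcludedMiddle (lsuc 0ℓ)) where

  dec : (X : Set) → Dec X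
  dec X = map′ lower lift em

  module _ {Ω : Set} where

    ¬⊆⇒∖-nonempty : {A B : Subset Ω} → ¬ (A ⊆ B) → Nonempty (A ∖ B)
    ¬⊆⇒∖-nonempty {A} {B} A⊈B with dec (Nonempty (A ∖ B))
    ... | yes A∖B≠∅ = A∖B≠∅
    ... | no A∖B=∅ = ⊥-elim (A⊈B A⊆B)
      where
        A⊆B : A ⊆ B
        A⊆B x Ax with dec (B x)
        ... | yes Bx = Bx
        ... | no ¬Bx = ⊥-elim (A∖B=∅ (x , Ax , ¬Bx))

    ⊆-∩-∪-∖ : {A B : Subset Ω} → A ⊆ ((A ∩ B) ∪ (A ∖ B))
    ⊆-∩-∪-∖ {B = B} x Ax with dec (B x)
    ... | yes Bx = inj₁ (Ax , Bx)
    ... | no ¬Bx = inj₂ (Ax , ¬Bx)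

    ¬overlap⇒nested-or-disjoint : {A B : Subset Ω} → ¬ Overlap A B → A ⊆ B ⊎ B ⊆ A ⊎ Disjoint A B
    ¬overlap⇒nested-or-disjoint {A} {B} ¬o with dec (A ⊆ B) | dec (B ⊆ A) | dec (Nonempty (A ∩ B))
    ... | yes A⊆B | _        | _       = inj₁ A⊆B
    ... | no _    | yes B⊆A  | _       = inj₂ (inj₁ B⊆A)
    ... | no _    | no _     | no A∩B=∅ = inj₂ (inj₂ A∩B=∅)
    ... | no A⊈B  | no B⊈A   | yes A∩B≠∅ = ⊥-elim (¬o (A∩B≠∅ , A⊈B , B⊈A))

  module _ {Ω : Set} {P : List (Subset Ω)} (pw : IsPatchwork P) where

    private
      closure = proj₂ (proj₂ pw)

    ∩-∈P : {A B : Subset Ω} → A ∈P P → B ∈P P → Overlap A B → (A ∩ B) ∈P P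
    ∩-∈P a b o = proj₁ (closure _ _ a b o)

    ∪-∈P : {A B : Subset Ω} → A ∈P P → B ∈P P → Overlap A B → (A ∪ B) ∈P P
    ∪-∈P a b o = proj₁ (proj₂ (closure _ _ a b o))

    ∖-∈P : {A B : Subset Ω} → A ∈P P → B ∈P P → Overlap A B → (A ∖ B) ∈P P
    ∖-∈P a b o = proj₂ (proj₂ (closure _ _ a b o))

    autonomous-meets⇒⊆ : {M V : Subset Ω} → Autonomous P M → V ∈P P →
                         Nonempty (M ∩ V) → ¬ V ⊆ M → M ⊆ V
    autonomous-meets⇒⊆ autM v M∩V≠∅ V⊈M
      with ¬overlap⇒nested-or-disjoint (autonomous⇒¬overlap autM v)
    ... | inj₁ M⊆V = M⊆V
    ... | inj₂ (inj₁ V⊆M) = ⊥-elim (V⊈M V⊆M)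
    ... | inj₂ (inj₂ M∩V=∅) = ⊥-elim (M∩V=∅ M∩V≠∅)

    -- U and V ∪ D share the points of V, so they are nested or overlap.
    ∪-adjacent-∈P : {U V D : Subset Ω} → U ∈P P → V ⊆ U → Nonempty V → Adjacent P V D →
                    (U ∪ D) ∈P P
    ∪-adjacent-∈P {U} {V} {D} u V⊆U (v , Vv) (_ , _ , _ , v∪d) with dec (D ⊆ U)
    ... | yes D⊆U = ∈P-resp-≐ (⊆-∪ˡ , ∪-⊆ ⊆-refl D⊆U) u
    ... | no D⊈U with dec (U ⊆ (V ∪ D))
    ...   | yes U⊆V∪D = ∈P-resp-≐ (∪-⊆ (⊆-trans V⊆U ⊆-∪ˡ) ⊆-∪ʳ , ∪-⊆ U⊆V∪D ⊆-∪ʳ) v∪d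
    ...   | no U⊈V∪D = ∈P-resp-≐ U∪V∪D≐U∪D (∪-∈P u v∪d U-overlaps-V∪D)
      where
        U-overlaps-V∪D : Overlap U (V ∪ D)
        U-overlaps-V∪D = (v , V⊆U v Vv , inj₁ Vv) , U⊈V∪D , (λ V∪D⊆U → D⊈U (⊆-trans ⊆-∪ʳ V∪D⊆U))
        U∪V∪D≐U∪D : (U ∪ (V ∪ D)) ≐ (U ∪ D)
        U∪V∪D≐U∪D = ∪-⊆ ⊆-∪ˡ (∪-⊆ (⊆-trans V⊆U ⊆-∪ˡ) ⊆-∪ʳ) , ∪-⊆ ⊆-∪ˡ (⊆-trans ⊆-∪ʳ ⊆-∪ʳ)

    module _ {F : List (Subset Ω)} {A : Subset Ω}
             (F-nonempty : ∀ {C} → C ∈ F → Nonempty C) (F-⊆ : ∀ {C} → C ∈ F → C ⊆ A) where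

      walk-extend : {U V D : Subset Ω} → Walk P F V D → Nonempty V → U ∈P P → V ⊆ U → U ⊆ A →
                    ∃ λ U' → U' ∈P P × U ⊆ U' × D ⊆ U' × U' ⊆ A
      walk-extend (here V≐D) _ u V⊆U U⊆A = _ , u , ⊆-refl , ⊆-trans (proj₂ V≐D) V⊆U , U⊆A
      walk-extend (step c adj w) V≠∅ u V⊆U U⊆A
        with walk-extend w (F-nonempty c) (∪-adjacent-∈P u V⊆U V≠∅ adj) ⊆-∪ʳ (∪-⊆ U⊆A (F-⊆ c))
      ... | U' , u' , U∪C⊆U' , D⊆U' , U'⊆A = U' , u' , ⊆-trans ⊆-∪ˡ U∪C⊆U' , D⊆U' , U'⊆A

      absorb : {C₀ : Subset Ω} → C₀ ∈ F → C₀ ∈P P → Connected P F →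
               (L : List (Subset Ω)) → (∀ {C} → C ∈ L → C ∈ F) →
               ∃ λ U → U ∈P P × C₀ ⊆ U × U ⊆ A × (∀ {C} → C ∈ L → C ⊆ U)
      absorb c₀ c₀∈P _ [] _ = _ , c₀∈P , ⊆-refl , F-⊆ c₀ , λ ()
      absorb c₀ c₀∈P conn (D ∷ L) L⊆F with absorb c₀ c₀∈P conn L (λ c → L⊆F (there c))
      ... | U , u , C₀⊆U , U⊆A , L⊆U
        with walk-extend (conn c₀ (L⊆F (here refl))) (F-nonempty c₀) u C₀⊆U U⊆A
      ...   | U' , u' , U⊆U' , D⊆U' , U'⊆A = U' , u' , ⊆-trans C₀⊆U U⊆U' , U'⊆A , D∷L⊆U'
        where
          D∷L⊆U' : ∀ {C} → C ∈ D ∷ L → C ⊆ U'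
          D∷L⊆U' (here refl) = D⊆U'
          D∷L⊆U' (there c) = ⊆-trans (L⊆U c) U⊆U'

    connected-union-∈P : {A : Subset Ω} (F : List (Subset Ω)) →
                         All (λ C → C ∈P P × Nonempty C) F → A IsUnionOf F → Connected P F →
                         A ∈P P
    connected-union-∈P [] _ A=⋃F _ = ∈P-resp-≐ ((λ _ ()) , ⊆-union A=⋃F λ ()) (proj₁ pw)
    connected-union-∈P (C₀ ∷ F) members A=⋃F conn
      with absorb (λ c → proj₂ (All.lookup members c)) (union-⊇ A=⋃F) (here refl)
                  (proj₁ (All.lookup members (here refl))) conn (C₀ ∷ F) (λ c → c)
    ... | U , u , _ , U⊆A , F⊆U = ∈P-resp-≐ (U⊆A , ⊆-union A=⋃F F⊆U) u

    minimal-∋-autonomous : {M : Subset Ω} {x : Ω} → M ∈P P → M x →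
                           (∀ {E} → E ∈ P → E x → E ⊆ M → M ⊆ E) → Autonomous P M
    minimal-∋-autonomous {M} {x} m Mx M-min = m , (x , Mx) , All.tabulate ¬overlap
      where
        M-min' : ∀ {E} → E ∈P P → E x → E ⊆ M → M ⊆ E
        M-min' e Ex E⊆M with find e
        ... | E' , e' , (E⊆E' , E'⊆E) = ⊆-trans (M-min e' (E⊆E' x Ex) (⊆-trans E'⊆E E⊆M)) E'⊆E
        ¬overlap : ∀ {B} → B ∈ P → ¬ Overlap M B
        ¬overlap {B} b o@((y , My , By) , M⊈B , _) with dec (B x)
        ... | yes Bx = M⊈B (⊆-trans (M-min' (∩-∈P m (∈⇒∈P b) o) (Mx , Bx) ∩-⊆ˡ) (λ _ → proj₂))
        ... | no ¬Bx = proj₂ (M-min' (∖-∈P m (∈⇒∈P b) o) (Mx , ¬Bx) ∖-⊆ y My) By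

    module Decomposition {A : Subset Ω} (a : A ∈P P) where

      MaximalAutonomous : Subset Ω → Set₁
      MaximalAutonomous C =
        Autonomous P C × C ⊆ A × (∀ {E} → Autonomous P E → E ⊆ A → C ⊆ E → E ⊆ C)

      maximalAutonomous? : Decidable MaximalAutonomous
      maximalAutonomous? _ = em

      F : List (Subset Ω)
      F = filter maximalAutonomous? P

      member-maximal : ∀ {C} → C ∈ F → MaximalAutonomous C
      member-maximal c = proj₂ (∈-filter⁻ maximalAutonomous? {xs = P} c)

      member-autonomous : ∀ {C} → C ∈ F → Autonomous P C
      member-autonomous c = proj₁ (member-maximal c)

      member-nonempty : ∀ {C} → C ∈ F → Nonempty C
      member-nonempty c = proj₁ (proj₂ (member-autonomous c))

      member-⊆ : ∀ {C} → C ∈ F → C ⊆ A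
      member-⊆ c = proj₁ (proj₂ (member-maximal c))

      nested-members-≐ : ∀ {C M} → C ∈ F → M ∈ F → C ⊆ M → C ≐ M
      nested-members-≐ c m C⊆M =
        C⊆M , proj₂ (proj₂ (member-maximal c)) (member-autonomous m) (member-⊆ m) C⊆M

      ∃-autonomous-∋ : ∀ {x} → A x → ∃ λ M → M ∈ P × Autonomous P M × M ⊆ A × M x
      ∃-autonomous-∋ {x} Ax with find a
      ... | A' , a' , (A⊆A' , A'⊆A)
        with maximal (λ U V → V ⊆ U) (λ U V → dec (V ⊆ U)) (λ U⊇V V⊇W → ⊆-trans V⊇W U⊇V)
                     (λ E → dec (E ⊆ A) ×-dec dec (E x)) P (lose a' (A'⊆A , A⊆A' x Ax))
      ...   | M , m , (M⊆A , Mx) , M-min =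
        M , m , minimal-∋-autonomous (∈⇒∈P m) Mx M-min' , M⊆A , Mx
        where
          M-min' : ∀ {E} → E ∈ P → E x → E ⊆ M → M ⊆ E
          M-min' e Ex E⊆M = M-min e (⊆-trans E⊆M M⊆A , Ex) E⊆M

      ∃-member-∋ : ∀ {x} → A x → ∃ λ C → C ∈ F × C x
      ∃-member-∋ {x} Ax with ∃-autonomous-∋ Ax
      ... | M , m , autM , M⊆A , Mx
        with maximal _⊆_ (λ U V → dec (U ⊆ V)) ⊆-trans
                     {Q = λ E → Autonomous P E × E ⊆ A × E x} (λ _ → em) P (lose m (autM , M⊆A , Mx))
      ...   | N , n , (autN , N⊆A , Nx) , N-max =
        N , ∈-filter⁺ maximalAutonomous? n (autN , N⊆A , N-max') , Nx
        where
          N-max' : ∀ {E} → Autonomous P E → E ⊆ A → N ⊆ E → E ⊆ N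
          N-max' autE E⊆A N⊆E with find (proj₁ autE)
          ... | E' , e' , E≐E'@(E⊆E' , E'⊆E) =
            ⊆-trans E⊆E'
              (N-max e' (autonomous-resp-≐ E≐E' autE , ⊆-trans E'⊆E E⊆A , E⊆E' x (N⊆E x Nx))
                     (⊆-trans N⊆E E⊆E'))

      member-meets : ∀ {C V} → C ∈ F → C ⊆ V → Nonempty (C ∩ V)
      member-meets c C⊆V with member-nonempty c
      ... | x , Cx = x , Cx , C⊆V x Cx

      Linked : Subset Ω → Set₁
      Linked W = ∀ {C D} → C ∈ F → D ∈ F → C ⊆ W → D ⊆ W → Walk P F C D

      Linked-anti : ∀ {V W} → V ⊆ W → Linked W → Linked V
      Linked-anti V⊆W linked c d C⊆V D⊆V = linked c d (⊆-trans C⊆V V⊆W) (⊆-trans D⊆V V⊆W)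

      Unlinked : Subset Ω → Subset Ω → Set₁
      Unlinked X Y = ∀ {M N} → M ∈ F → N ∈ F → M ⊆ X → N ⊆ Y → ¬ Walk P F M N

      Unlinked-sym : ∀ {X Y} → Unlinked X Y → Unlinked Y X
      Unlinked-sym unlinked n m N⊆Y M⊆X w = unlinked m n M⊆X N⊆Y (walk-reverse n w)

      module _ {W : Subset Ω} (w : W ∈P P) (W⊆A : W ⊆ A)
               (ih : ∀ {V} → V ∈P P → V ⊆ W → ¬ W ⊆ V → Linked V) where

        record Halving (X Y : Subset Ω) : Set₁ where
          field
            X∈P : X ∈P P
            X⊆W : X ⊆ W
            Y⊆W : Y ⊆ W
            disjoint : Disjoint X Y
            covers : W ⊆ (X ∪ Y)
            Y-nonempty : Nonempty Y
            sorted : ∀ {M} → M ∈ F → Nonempty (M ∩ W) → M ⊆ X ⊎ M ⊆ Y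

        halving-swap : ∀ {X Y} → Halving X Y → Y ∈P P → Nonempty X → Halving Y X
        halving-swap h y X≠∅ = record
          { X∈P = y ; X⊆W = Y⊆W ; Y⊆W = X⊆W ; disjoint = Disjoint-sym disjoint
          ; covers = ⊆-trans covers (proj₁ ∪-comm) ; Y-nonempty = X≠∅
          ; sorted = λ m M∩W≠∅ → swap (sorted m M∩W≠∅) }
          where open Halving h

        module _ {X Y : Subset Ω} (h : Halving X Y) (unlinked : Unlinked X Y) where
          open Halving h

          member-in-half : ∀ {x} → W x → ∃ λ M → M ∈ F × M x × (M ⊆ X ⊎ M ⊆ Y)
          member-in-half {x} Wx with ∃-member-∋ (W⊆A x Wx)
          ... | M , m , Mx = M , m , Mx , sorted m (x , Mx , Wx)

          no-straddling-proper-subset : ∀ {V} → V ∈P P → V ⊆ W → ¬ W ⊆ V →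
                                        Nonempty (V ∩ X) → Nonempty (V ∩ Y) → ⊥
          no-straddling-proper-subset {V} v V⊆W W⊈V (x , Vx , Xx) (y , Vy , Yy)
            with member-in-half (X⊆W x Xx) | member-in-half (Y⊆W y Yy)
          ... | _ , _ , Mx , inj₂ M⊆Y | _ = disjoint (x , Xx , M⊆Y x Mx)
          ... | _ , _ , _ , inj₁ _ | _ , _ , Ny , inj₁ N⊆X = disjoint (y , N⊆X y Ny , Yy)
          ... | M , m , Mx , inj₁ M⊆X | N , n , Ny , inj₂ N⊆Y =
            unlinked m n M⊆X N⊆Y (ih v V⊆W W⊈V m n M⊆V N⊆V)
            where
              M⊆V : M ⊆ V
              M⊆V = autonomous-meets⇒⊆ (member-autonomous m) v (x , Mx , Vx)
                      (λ V⊆M → disjoint (y , M⊆X y (V⊆M y Vy) , Yy))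
              N⊆V : N ⊆ V
              N⊆V = autonomous-meets⇒⊆ (member-autonomous n) v (y , Ny , Vy)
                      (λ V⊆N → disjoint (x , Xx , N⊆Y x (V⊆N x Vx)))

          -- A P-set Z overlapping X yields a straddling proper P-subset of W: Z itself,
          -- W ∩ Z, or W ∖ Z.
          ¬overlap : ∀ {Z} → Z ∈ P → ¬ Overlap X Z
          ¬overlap {Z} z ((p , Xp , Zp) , X⊈Z , Z⊈X) with dec (W ⊆ Z) | dec (Z ⊆ W)
          ... | yes W⊆Z | _ = X⊈Z (⊆-trans X⊆W W⊆Z)
          ... | no W⊈Z | yes Z⊆W with ¬⊆⇒∖-nonempty Z⊈X
          ...   | r , Zr , ¬Xr = no-straddling-proper-subset (∈⇒∈P z) Z⊆W W⊈Z (p , Zp , Xp) (r , Zr , Yr)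
            where
              Yr : Y r
              Yr with covers r (Z⊆W r Zr)
              ... | inj₁ Xr = ⊥-elim (¬Xr Xr)
              ... | inj₂ Yr = Yr
          ¬overlap {Z} z ((p , Xp , Zp) , X⊈Z , Z⊈X) | no W⊈Z | no Z⊈W
            with dec (Nonempty (Z ∩ Y))
          ... | yes (y , Zy , Yy) =
            no-straddling-proper-subset (∩-∈P w (∈⇒∈P z) W-overlaps-Z) ∩-⊆ˡ
              (λ W⊆W∩Z → W⊈Z (λ x Wx → proj₂ (W⊆W∩Z x Wx)))
              (p , (X⊆W p Xp , Zp) , Xp) (y , (Y⊆W y Yy , Zy) , Yy)
            where
              W-overlaps-Z : Overlap W Z
              W-overlaps-Z = (p , X⊆W p Xp , Zp) , W⊈Z , Z⊈W
          ... | no Z∩Y=∅ with ¬⊆⇒∖-nonempty X⊈Z | Y-nonempty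
          ...   | q , Xq , ¬Zq | y , Yy =
            no-straddling-proper-subset (∖-∈P w (∈⇒∈P z) W-overlaps-Z) ∖-⊆
              (λ W⊆W∖Z → proj₂ (W⊆W∖Z p (X⊆W p Xp)) Zp)
              (q , (X⊆W q Xq , ¬Zq) , Xq) (y , (Y⊆W y Yy , λ Zy → Z∩Y=∅ (y , Zy , Yy)) , Yy)
            where
              W-overlaps-Z : Overlap W Z
              W-overlaps-Z = (p , X⊆W p Xp , Zp) , W⊈Z , Z⊈W

          unlinked-half-autonomous : Nonempty X → Autonomous P X
          unlinked-half-autonomous X≠∅ = X∈P , X≠∅ , All.tabulate ¬overlap

        module _ (W⊈member : ∀ {M} → M ∈ F → ¬ W ⊆ M) where

          member-meets⇒⊆ : ∀ {M} → M ∈ F → Nonempty (M ∩ W) → M ⊆ W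
          member-meets⇒⊆ m M∩W≠∅ = autonomous-meets⇒⊆ (member-autonomous m) w M∩W≠∅ (W⊈member m)

          ¬autonomous : Nonempty W → ¬ Autonomous P W
          ¬autonomous (x , Wx) autW with ∃-member-∋ (W⊆A x Wx)
          ... | M , m , Mx =
            W⊈member m (proj₂ (proj₂ (member-maximal m)) autW W⊆A (member-meets⇒⊆ m (x , Mx , Wx)))

          overlapping : Nonempty W → ∃ λ B → B ∈ P × Overlap W B
          overlapping W≠∅ with em {Any (Overlap W) P}
          ... | yes o = find o
          ... | no ¬o = ⊥-elim (¬autonomous W≠∅ (w , W≠∅ , ¬Any⇒All¬ P ¬o))

          module _ {B : Subset Ω} (b : B ∈ P) (o : Overlap W B) where

            halving : Halving (W ∩ B) (W ∖ B)
            halving = record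
              { X∈P = ∩-∈P w (∈⇒∈P b) o ; X⊆W = ∩-⊆ˡ ; Y⊆W = ∖-⊆
              ; disjoint = λ (_ , (_ , Bx) , (_ , ¬Bx)) → ¬Bx Bx
              ; covers = ⊆-∩-∪-∖ ; Y-nonempty = ¬⊆⇒∖-nonempty (proj₁ (proj₂ o))
              ; sorted = sorted }
              where
                sorted : ∀ {M} → M ∈ F → Nonempty (M ∩ W) → M ⊆ (W ∩ B) ⊎ M ⊆ (W ∖ B)
                sorted m M∩W≠∅
                  with member-meets⇒⊆ m M∩W≠∅
                     | ¬overlap⇒nested-or-disjoint (autonomous⇒¬overlap (member-autonomous m) (∈⇒∈P b))
                ... | M⊆W | inj₁ M⊆B = inj₁ (λ x Mx → M⊆W x Mx , M⊆B x Mx)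
                ... | M⊆W | inj₂ (inj₁ B⊆M) = ⊥-elim (proj₂ (proj₂ o) (⊆-trans B⊆M M⊆W))
                ... | M⊆W | inj₂ (inj₂ M∩B=∅) = inj₂ (λ x Mx → M⊆W x Mx , λ Bx → M∩B=∅ (x , Mx , Bx))

            W⊈W∩B : ¬ W ⊆ (W ∩ B)
            W⊈W∩B W⊆W∩B = proj₁ (proj₂ o) (λ x Wx → proj₂ (W⊆W∩B x Wx))

            W⊈W∖B : ¬ W ⊆ (W ∖ B)
            W⊈W∖B W⊆W∖B with proj₁ o
            ... | p , Wp , Bp = proj₂ (W⊆W∖B p Wp) Bp

            cross-walk : ∀ {C D} → C ∈ F → D ∈ F → C ⊆ (W ∩ B) → D ⊆ (W ∖ B) → Walk P F C D
            cross-walk {C} {D} c d C⊆X D⊆Y with em {Walk P F C D}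
            ... | yes walk = walk
            ... | no ¬walk = step d (proj₁ (member-autonomous c) , proj₁ (member-autonomous d) ,
                                     C∩D=∅ , ∈P-resp-≐ W≐C∪D w) (here ≐-refl)
              where
                unlinked : Unlinked (W ∩ B) (W ∖ B)
                unlinked m n M⊆X N⊆Y walk =
                  ¬walk (ih (∩-∈P w (∈⇒∈P b) o) ∩-⊆ˡ W⊈W∩B c m C⊆X M⊆X ◅◅ walk ◅◅
                         ih (∖-∈P w (∈⇒∈P b) o) ∖-⊆ W⊈W∖B n d N⊆Y D⊆Y)
                X≠∅ : Nonempty (W ∩ B)
                X≠∅ with member-nonempty c
                ... | x , Cx = x , C⊆X x Cx
                Y≠∅ : Nonempty (W ∖ B)
                Y≠∅ with member-nonempty d
                ... | x , Dx = x , D⊆Y x Dx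
                X⊆C : (W ∩ B) ⊆ C
                X⊆C = proj₂ (proj₂ (member-maximal c))
                        (unlinked-half-autonomous halving unlinked X≠∅) (⊆-trans ∩-⊆ˡ W⊆A) C⊆X
                Y⊆D : (W ∖ B) ⊆ D
                Y⊆D = proj₂ (proj₂ (member-maximal d))
                        (unlinked-half-autonomous (halving-swap halving (∖-∈P w (∈⇒∈P b) o) X≠∅)
                           (Unlinked-sym unlinked) Y≠∅)
                        (⊆-trans ∖-⊆ W⊆A) D⊆Y
                W≐C∪D : W ≐ (C ∪ D)
                W≐C∪D = ⊆-trans ⊆-∩-∪-∖ (∪-⊆ (⊆-trans X⊆C ⊆-∪ˡ) (⊆-trans Y⊆D ⊆-∪ʳ))
                      , ∪-⊆ (⊆-trans C⊆X ∩-⊆ˡ) (⊆-trans D⊆Y ∖-⊆)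
                C∩D=∅ : Disjoint C D
                C∩D=∅ (x , Cx , Dx) = proj₂ (D⊆Y x Dx) (proj₂ (C⊆X x Cx))

            split-walk : Linked W
            split-walk c d C⊆W D⊆W
              with Halving.sorted halving c (member-meets c C⊆W) | Halving.sorted halving d (member-meets d D⊆W)
            ... | inj₁ C⊆X | inj₁ D⊆X = ih (∩-∈P w (∈⇒∈P b) o) ∩-⊆ˡ W⊈W∩B c d C⊆X D⊆X
            ... | inj₂ C⊆Y | inj₂ D⊆Y = ih (∖-∈P w (∈⇒∈P b) o) ∖-⊆ W⊈W∖B c d C⊆Y D⊆Y
            ... | inj₁ C⊆X | inj₂ D⊆Y = cross-walk c d C⊆X D⊆Y
            ... | inj₂ C⊆Y | inj₁ D⊆X = walk-reverse d (cross-walk d c D⊆X C⊆Y)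

          linked-across : Linked W
          linked-across c d C⊆W D⊆W with member-meets c C⊆W
          ... | x , _ , Wx with overlapping (x , Wx)
          ...   | B , b , o = split-walk b o c d C⊆W D⊆W

        linked : Linked W
        linked {C} {D} c d C⊆W D⊆W with em {Any (W ⊆_) F}
        ... | yes W⊆member with find W⊆member
        ...   | M , m , W⊆M = here (≐-trans (nested-members-≐ c m (⊆-trans C⊆W W⊆M))
                                            (≐-sym (nested-members-≐ d m (⊆-trans D⊆W W⊆M))))
        linked c d C⊆W D⊆W | no ¬W⊆member =
          linked-across (λ m W⊆M → ¬W⊆member (lose m W⊆M)) c d C⊆W D⊆W

      linked-⊆ : ∀ {W} → W ∈ P → W ⊆ A → Linked W
      linked-⊆ = finite-induction (λ U V → V ⊆ U) (λ U V → dec (V ⊆ U))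
                   (λ U⊇V V⊇W → ⊆-trans V⊇W U⊇V) {Q = λ W → W ⊆ A → Linked W} (λ _ → em) P
                   (λ w ind W⊆A → linked (∈⇒∈P w) W⊆A (λ v V⊆W W⊈V → smaller ind W⊆A v V⊆W W⊈V))
        where
          smaller : ∀ {W V} → (∀ {V'} → V' ∈ P → V' ⊆ W → ¬ W ⊆ V' → V' ⊆ A → Linked V') →
                    W ⊆ A → V ∈P P → V ⊆ W → ¬ W ⊆ V → Linked V
          smaller ind W⊆A v V⊆W W⊈V with find v
          ... | V' , v' , (V⊆V' , V'⊆V) =
            Linked-anti V⊆V' (ind v' (⊆-trans V'⊆V V⊆W) (λ W⊆V' → W⊈V (⊆-trans W⊆V' V'⊆V))
                                  (⊆-trans (⊆-trans V'⊆V V⊆W) W⊆A))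

      decomposition : ∃ λ F' → All (Autonomous P) F' × A IsUnionOf F' × Connected P F'
      decomposition = F , All.tabulate member-autonomous , A=⋃F , connected
        where
          A=⋃F : A IsUnionOf F
          A=⋃F x = ∃-member-∋ , λ (_ , c , Cx) → member-⊆ c x Cx
          connected : Connected P F
          connected c d with find a
          ... | A' , a' , (A⊆A' , A'⊆A) =
            Linked-anti A⊆A' (linked-⊆ a' A'⊆A) c d (member-⊆ c) (member-⊆ d)

lemma4p6 : ExcludedMiddle (lsuc 0ℓ) →
    {Ω : Set} (P : List (Subset Ω)) → IsPatchwork P →
    (A : Subset Ω) →
    (A ∈P P) ⇔ (∃ λ (F : List (Subset Ω)) →
                  All (Autonomous P) F × A IsUnionOf F × Connected P F)
lemma4p6 em P pw A = mk⇔ (λ a → Decomposition.decomposition em pw a)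
  (λ (F , autonomous , A=⋃F , connected) →
     connected-union-∈P em pw F (All.map (λ (c , C≠∅ , _) → c , C≠∅) autonomous) A=⋃F connected)
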